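{- For every positive integer $n$, the number of permutations of size $2n$ that avoid the vincular patterns $3\text{ - }14\text{ - }2$ and $3\text{ - }41\text{ - }2$ and are alternating starting with an ascent is $C_n^2$, and for every nonnegative integer $n$ the number of such permutations of size $2n+1$ is $C_n C_{n+1}$, where $C_m=\frac{1}{m+1}\binom{2m}{m}$.
   Context: A permutation $\sigma$ of size $m$ contains $3\text{ - }14\text{ - }2$ if there are indices $i<j<k$ with $j+1<k$ and $\sigma(j)<\sigma(k)<\sigma(i)<\sigma(j+1)$; it contains $3\text{ - }41\text{ - }2$ if there are indices $i<j<k$ with $j+1<k$ and $\sigma(j+1)<\sigma(k)<\sigma(i)<\sigma(j)$; it avoids a pattern if it does not contain it. A permutation is alternating starting with an ascent if $\sigma(1)<\sigma(2)>\sigma(3)<\sigma(4)>\cdots$, i.e. $\sigma(2i-1)<\sigma(2i)$ and $\sigma(2i)>\sigma(2i+1)$ whenever these entries are defined. -}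

module Defs where

open import Data.Nat using (ℕ; zero; suc; _+_; _*_; _/_; _<_)
open import Data.Nat.Combinatorics using (_C_)
open import Data.Fin using (Fin; toℕ) renaming (_<_ to _<ᶠ_)
open import Data.Vec using (Vec; lookup)
open import Data.List using (List; length)
open import Data.List.Membership.Propositional using (_∈_)
open import Data.List.Relation.Unary.Unique.Propositional using (Unique)
open import Data.Product using (Σ; ∃; _×_; _,_)
open import Function.Definitions using (Injective)
open import Function.Bundles using (_⇔_)
open import Relation.Binary.PropositionalEquality using (_≡_)
open import Relation.Nullary using (¬_)

-- A permutation of size m, in one-line notation: σ(1)…σ(m) stored as a
-- vector of values in Fin m (positions and values 0-indexed), bijective.
IsPerm : ∀ {m} → Vec (Fin m) m → Set
IsPerm σ = Injective _≡_ _≡_ (lookup σ)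

Contains3-14-2 : ∀ {m} → Vec (Fin m) m → Set
Contains3-14-2 {m} σ =
  Σ (Fin m) λ i → Σ (Fin m) λ j → Σ (Fin m) λ j′ → Σ (Fin m) λ k →
    (i <ᶠ j) × (toℕ j′ ≡ suc (toℕ j)) × (j′ <ᶠ k) ×
    (lookup σ j <ᶠ lookup σ k) × (lookup σ k <ᶠ lookup σ i) × (lookup σ i <ᶠ lookup σ j′)

Contains3-41-2 : ∀ {m} → Vec (Fin m) m → Set
Contains3-41-2 {m} σ =
  Σ (Fin m) λ i → Σ (Fin m) λ j → Σ (Fin m) λ j′ → Σ (Fin m) λ k →
    (i <ᶠ j) × (toℕ j′ ≡ suc (toℕ j)) × (j′ <ᶠ k) ×
    (lookup σ j′ <ᶠ lookup σ k) × (lookup σ k <ᶠ lookup σ i) × (lookup σ i <ᶠ lookup σ j)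

-- Alternating starting with an ascent: with 0-indexed positions p, p+1,
-- σ(p) < σ(p+1) when p is even and σ(p) > σ(p+1) when p is odd
-- (i.e. 1-indexed σ(2i-1) < σ(2i) > σ(2i+1)).
data Even : ℕ → Set where
  ev0 : Even 0
  ev2 : ∀ {n} → Even n → Even (suc (suc n))

AltAscent : ∀ {m} → Vec (Fin m) m → Set
AltAscent {m} σ = (p q : Fin m) → toℕ q ≡ suc (toℕ p) →
  (Even (toℕ p) → lookup σ p <ᶠ lookup σ q) ×
  (¬ Even (toℕ p) → lookup σ q <ᶠ lookup σ p)

Good : ∀ {m} → Vec (Fin m) m → Set
Good σ = IsPerm σ × ¬ Contains3-14-2 σ × ¬ Contains3-41-2 σ × AltAscent σ

-- "Exactly c objects of type A satisfy P": a duplicate-free list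
-- of length c enumerating precisely the objects satisfying P.
HasCount : {A : Set} → (A → Set) → ℕ → Set
HasCount {A} P c = Σ (List A) λ L →
  Unique L × (length L ≡ c) × (∀ x → (x ∈ L) ⇔ P x)

catalan : ℕ → ℕ
catalan m = ((m + m) C m) / suc m

module Submission where

-- A good permutation of size m + 2 arises in exactly one way by appending a last value to a good
-- permutation of size m + 1 and renumbering. Call a gap of the shorter permutation blocked if
-- appending it would complete a 3-14-2 or 3-41-2 ending at the new entry; the admissible last values
-- are the unblocked gaps on the side of the old last value required by the alternation. Labelling a
-- permutation by the numbers (a, b) of unblocked gaps below and above its last value gives a
-- generating tree with root (1, 1) and rules (a, b) ↦ (a + 1, i + 1), i < b, when the next step is
-- an ascent and (a, b) ↦ (i + 1, b + 1), i < a, when it is a descent. Summing F(a, b) over a level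
-- therefore transforms F linearly; on F(a, b) = ballot j (a + 1) · ballot j′ b two levels just
-- raise j and j′, and the ballot numbers ballot n 1 are the Catalan numbers.

open import Defs
open import Data.Nat
open import Data.Nat.Properties
open import Data.Nat.Combinatorics using (_C_; nCk+nC[k+1]≡[n+1]C[k+1]; k>n⇒nCk≡0; nCk≡nC[n∸k]; nC1≡n)
open import Data.Nat.DivMod using (m*n/n≡m)
open import Data.Nat.Tactic.RingSolver using (solve-∀)
open import Data.Fin using (Fin; toℕ; fromℕ<; punchIn; punchOut; zero; suc) renaming (_<_ to _<ᶠ_)
open import Data.Fin.Properties using (toℕ-injective; toℕ-fromℕ<; toℕ<n; punchIn-punchOut; pigeonhole; any?; punchOut-injective) renaming (_≟_ to _≟ᶠ_)
open import Function.Definitions using (Injective)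
open import Data.Vec using (Vec; []; _∷_; lookup; map; _∷ʳ_; initLast)
open import Data.Vec.Properties using (∷ʳ-injective)
open import Data.List using (List; []; _∷_; [_]; _++_; filter; allFin; concatMap; length; tabulate)
  renaming (map to mapL)
open import Data.List.Properties using (map-∘; map-++; map-tabulate; map-cong-local)
open import Data.List.Membership.Propositional using (_∈_; find; lose)
open import Data.List.Membership.Propositional.Properties using (∈-map⁺; ∈-map⁻; ∈-filter⁺; ∈-filter⁻; ∈-allFin; ∈-concatMap⁺; ∈-concatMap⁻)
import Data.List.Relation.Unary.All as All
import Data.List.Relation.Unary.All.Properties as Allₚ
import Data.List.Relation.Unary.AllPairs as AllPairs
import Data.List.Relation.Unary.AllPairs.Properties as AllPairsₚ
open import Data.List.Relation.Unary.Any using (here)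
open import Data.List.Relation.Unary.Unique.Propositional using (Unique)
open import Data.List.Relation.Binary.Disjoint.Propositional using (Disjoint)
open import Data.List.Relation.Unary.Unique.Propositional.Properties using (concat⁺; map⁺; filter⁺; allFin⁺)
open import Data.Nat.ListAction using (sum)
open import Data.Nat.ListAction.Properties using (sum-++)
open import Function using (_∘_; case_of_)
open import Function.Bundles using (_⇔_; mk⇔; module Equivalence)
open Equivalence using (to; from)
open import Relation.Binary.PropositionalEquality using (_≡_; _≢_; refl; sym; trans; cong; cong₂; subst; subst₂; module ≡-Reasoning)
open import Data.Product using (Σ; _×_; _,_; proj₁; proj₂; map₁)
open import Data.Sum using (_⊎_; inj₁; inj₂)
open import Data.Empty using (⊥-elim)
open import Relation.Nullary using (¬_; Dec; yes; no; ¬?; _×-dec_; _⊎-dec_)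
open import Relation.Nullary.Decidable using (map′)

∑< : ℕ → (ℕ → ℕ) → ℕ
∑< zero    f = 0
∑< (suc n) f = f 0 + ∑< n (f ∘ suc)

∑<-cong : ∀ n {f g : ℕ → ℕ} → (∀ i → f i ≡ g i) → ∑< n f ≡ ∑< n g
∑<-cong zero    f≗g = refl
∑<-cong (suc n) f≗g = cong₂ _+_ (f≗g 0) (∑<-cong n (f≗g ∘ suc))

∑<-snoc : ∀ n (f : ℕ → ℕ) → ∑< (suc n) f ≡ ∑< n f + f n
∑<-snoc zero    f = +-comm (f 0) 0
∑<-snoc (suc n) f = begin
  f 0 + ∑< (suc n) (f ∘ suc)   ≡⟨ cong (f 0 +_) (∑<-snoc n (f ∘ suc)) ⟩
  f 0 + (∑< n (f ∘ suc) + f (suc n)) ≡⟨ +-assoc (f 0) _ _ ⟨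
  f 0 + ∑< n (f ∘ suc) + f (suc n)   ∎
  where open ≡-Reasoning

∑<-const0 : ∀ n → ∑< n (λ _ → 0) ≡ 0
∑<-const0 zero    = refl
∑<-const0 (suc n) = ∑<-const0 n

∑<-const1 : ∀ n → ∑< n (λ _ → 1) ≡ n
∑<-const1 zero    = refl
∑<-const1 (suc n) = cong suc (∑<-const1 n)

∑<-*ˡ : ∀ n (f : ℕ → ℕ) x → ∑< n (λ i → x * f i) ≡ x * ∑< n f
∑<-*ˡ zero    f x = sym (*-zeroʳ x)
∑<-*ˡ (suc n) f x = trans (cong (x * f 0 +_) (∑<-*ˡ n (f ∘ suc) x)) (sym (*-distribˡ-+ x (f 0) _))

∑<-*ʳ : ∀ n (f : ℕ → ℕ) x → ∑< n (λ i → f i * x) ≡ ∑< n f * x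
∑<-*ʳ zero    f x = refl
∑<-*ʳ (suc n) f x = trans (cong (f 0 * x +_) (∑<-*ʳ n (f ∘ suc) x)) (sym (*-distribʳ-+ x (f 0) _))

_when_ : ∀ {P : Set} → ℕ → Dec P → ℕ
x when yes _ = x
x when no  _ = 0

⟦_⟧ : ∀ {P : Set} → Dec P → ℕ
⟦ d ⟧ = 1 when d

when-cong : ∀ {P Q : Set} x → P ⇔ Q → (d : Dec P) (e : Dec Q) → x when d ≡ x when e
when-cong x P⇔Q (yes p) (yes q) = refl
when-cong x P⇔Q (yes p) (no ¬q) = ⊥-elim (¬q (to P⇔Q p))
when-cong x P⇔Q (no ¬p) (yes q) = ⊥-elim (¬p (from P⇔Q q))
when-cong x P⇔Q (no ¬p) (no ¬q) = refl

when-yes : ∀ {P : Set} x → P → (d : Dec P) → x when d ≡ x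
when-yes x p (yes _) = refl
when-yes x p (no ¬p) = ⊥-elim (¬p p)

when-no : ∀ {P : Set} x → ¬ P → (d : Dec P) → x when d ≡ 0
when-no x ¬p (yes p) = ⊥-elim (¬p p)
when-no x ¬p (no _)  = refl

count : ∀ {P : ℕ → Set} → (∀ q → Dec (P q)) → ℕ → ℕ
count P? N = ∑< N (λ q → ⟦ P? q ⟧)

count-cong : ∀ {P Q : ℕ → Set} (P? : ∀ q → Dec (P q)) (Q? : ∀ q → Dec (Q q)) → (∀ q → P q ⇔ Q q) →
             ∀ N → count P? N ≡ count Q? N
count-cong P? Q? P⇔Q N = ∑<-cong N (λ q → when-cong 1 (P⇔Q q) (P? q) (Q? q))

countFrom : ∀ {P : ℕ → Set} → (∀ q → Dec (P q)) → ℕ → ℕ → ℕ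
countFrom P? N g = count (λ q → g ≤? q ×-dec P? q) N

count-below : ∀ {P : ℕ → Set} (P? : ∀ q → Dec (P q)) N g → g ≤ N → count (λ q → q <? g ×-dec P? q) N ≡ count P? g
count-below P? N zero _ = trans (∑<-cong N (λ q → when-no 1 (λ ()) (q <? 0 ×-dec P? q))) (∑<-const0 N)
count-below P? (suc N) (suc g) g≤N = cong₂ _+_
  (when-cong 1 (mk⇔ proj₂ (z<s ,_)) _ _)
  (trans (∑<-cong N (λ q → when-cong 1 (mk⇔ (map₁ s≤s⁻¹) (map₁ s≤s)) _ _))
         (count-below (P? ∘ suc) N g (s≤s⁻¹ g≤N)))

countFrom-zero : ∀ {P : ℕ → Set} (P? : ∀ q → Dec (P q)) N → countFrom P? N 0 ≡ count P? N
countFrom-zero P? N = count-cong _ P? (λ _ → mk⇔ proj₂ (z≤n ,_)) N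

countFrom-suc : ∀ {P : ℕ → Set} (P? : ∀ q → Dec (P q)) N g → countFrom P? (suc N) (suc g) ≡ countFrom (P? ∘ suc) N g
countFrom-suc P? N g = cong₂ _+_ (when-no 1 (λ ()) (suc g ≤? 0 ×-dec P? 0))
                                 (count-cong _ _ (λ _ → mk⇔ (map₁ s≤s⁻¹) (map₁ s≤s)) N)

countFrom-split : ∀ {P : ℕ → Set} (P? : ∀ q → Dec (P q)) N g → g < N → countFrom P? N g ≡ ⟦ P? g ⟧ + countFrom P? N (suc g)
countFrom-split P? (suc N) zero _ = begin
  countFrom P? (suc N) 0                    ≡⟨ countFrom-zero P? (suc N) ⟩
  ⟦ P? 0 ⟧ + count (P? ∘ suc) N             ≡⟨ cong (⟦ P? 0 ⟧ +_) (countFrom-zero (P? ∘ suc) N) ⟨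
  ⟦ P? 0 ⟧ + countFrom (P? ∘ suc) N 0       ≡⟨ cong (⟦ P? 0 ⟧ +_) (countFrom-suc P? N 0) ⟨
  ⟦ P? 0 ⟧ + countFrom P? (suc N) 1         ∎
  where open ≡-Reasoning
countFrom-split P? (suc N) (suc g) g<N = begin
  countFrom P? (suc N) (suc g)                          ≡⟨ countFrom-suc P? N g ⟩
  countFrom (P? ∘ suc) N g                              ≡⟨ countFrom-split (P? ∘ suc) N g (s≤s⁻¹ g<N) ⟩
  ⟦ P? (suc g) ⟧ + countFrom (P? ∘ suc) N (suc g)       ≡⟨ cong (⟦ P? (suc g) ⟧ +_) (countFrom-suc P? N (suc g)) ⟨
  ⟦ P? (suc g) ⟧ + countFrom P? (suc N) (suc (suc g))   ∎
  where open ≡-Reasoning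

∑<-⟦⟧+ : ∀ {P : Set} (d : Dec P) c (f : ℕ → ℕ) → ∑< (⟦ d ⟧ + c) f ≡ f c when d + ∑< c f
∑<-⟦⟧+ (yes _) c f = trans (∑<-snoc c f) (+-comm (∑< c f) (f c))
∑<-⟦⟧+ (no _)  c f = refl

∑-rank-below : ∀ {P : ℕ → Set} (P? : ∀ q → Dec (P q)) N (h : ℕ → ℕ) →
               ∑< N (λ g → h (count P? g) when P? g) ≡ ∑< (count P? N) h
∑-rank-below P? zero    h = refl
∑-rank-below P? (suc N) h = begin
  ∑< (suc N) (λ g → h (count P? g) when P? g)          ≡⟨ ∑<-snoc N _ ⟩
  ∑< N (λ g → h (count P? g) when P? g) + last        ≡⟨ cong (_+ last) (∑-rank-below P? N h) ⟩
  ∑< (count P? N) h + last                            ≡⟨ +-comm (∑< (count P? N) h) last ⟩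
  last + ∑< (count P? N) h                            ≡⟨ ∑<-⟦⟧+ (P? N) (count P? N) h ⟨
  ∑< (⟦ P? N ⟧ + count P? N) h                        ≡⟨ cong (λ c → ∑< c h) (trans (+-comm ⟦ P? N ⟧ _) (sym (∑<-snoc N _))) ⟩
  ∑< (count P? (suc N)) h                             ∎
  where
  open ≡-Reasoning
  last : ℕ
  last = h (count P? N) when P? N

∑-rank-above : ∀ {P : ℕ → Set} (P? : ∀ q → Dec (P q)) N (h : ℕ → ℕ) →
               ∑< N (λ g → h (countFrom P? N g) when P? g) ≡ ∑< (count P? N) (h ∘ suc)
∑-rank-above P? zero    h = refl
∑-rank-above {P} P? (suc N) h = begin
  h (countFrom P? (suc N) 0) when P? 0 + ∑< N (λ g → h (countFrom P? (suc N) (suc g)) when P? (suc g))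
    ≡⟨ cong₂ (λ x y → h x when P? 0 + y) (countFrom-zero P? (suc N))
             (∑<-cong N (λ g → cong (λ x → h x when P? (suc g)) (countFrom-suc P? N g))) ⟩
  h (⟦ P? 0 ⟧ + T) when P? 0 + ∑< N (λ g → h (countFrom (P? ∘ suc) N g) when P? (suc g))
    ≡⟨ cong (h (⟦ P? 0 ⟧ + T) when P? 0 +_) (∑-rank-above (P? ∘ suc) N h) ⟩
  h (⟦ P? 0 ⟧ + T) when P? 0 + ∑< T (h ∘ suc)
    ≡⟨ first (P? 0) ⟩
  ∑< (⟦ P? 0 ⟧ + T) (h ∘ suc) ∎
  where
  open ≡-Reasoning
  T : ℕ
  T = count (P? ∘ suc) N
  first : (d : Dec (P 0)) → h (⟦ d ⟧ + T) when d + ∑< T (h ∘ suc) ≡ ∑< (⟦ d ⟧ + T) (h ∘ suc)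
  first d@(yes _) = sym (∑<-⟦⟧+ d T (h ∘ suc))
  first d@(no _)  = refl

ballot : ℕ → ℕ → ℕ
ballot zero    b = 1
ballot (suc k) b = ∑< b (λ c → ballot k (2 + c))

ballot-suc : ∀ k b → ballot (suc k) (suc b) ≡ ballot (suc k) b + ballot k (2 + b)
ballot-suc k b = ∑<-snoc b (λ c → ballot k (2 + c))

C-symmetric : ∀ a b → (a + b) C a ≡ (a + b) C b
C-symmetric a b = trans (nCk≡nC[n∸k] (m≤m+n a b)) (cong ((a + b) C_) (m+n∸m≡n a b))

-- ballot (k+1) (b+1) = C(N, k+1) − C(N, k), stated without truncated subtraction.
ballot-binomial : ∀ k b → let N = suc k + suc k + b in ballot (suc k) (suc b) + N C k ≡ N C suc k
ballot-binomial zero b = begin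
  ∑< (suc b) (λ _ → 1) + 1 ≡⟨ cong (_+ 1) (∑<-const1 (suc b)) ⟩
  suc b + 1                ≡⟨ +-comm (suc b) 1 ⟩
  suc (suc b)              ≡⟨ nC1≡n (suc (suc b)) ⟨
  suc (suc b) C 1          ∎
  where open ≡-Reasoning
ballot-binomial (suc k) zero = begin
  ballot (suc k) 2 + 0 + N C suc k   ≡⟨ cong₂ (λ x y → x + y C suc k) (+-identityʳ (ballot (suc k) 2)) N≡1+M ⟩
  ballot (suc k) 2 + suc M C suc k   ≡⟨ cong (ballot (suc k) 2 +_) (nCk+nC[k+1]≡[n+1]C[k+1] M k) ⟨
  ballot (suc k) 2 + (M C k + M C suc k) ≡⟨ +-assoc (ballot (suc k) 2) _ _ ⟨
  ballot (suc k) 2 + M C k + M C suc k   ≡⟨ cong (_+ M C suc k) (ballot-binomial k 1) ⟩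
  M C suc k + M C suc k              ≡⟨ cong (M C suc k +_) M-symmetric ⟩
  M C suc k + M C suc (suc k)        ≡⟨ nCk+nC[k+1]≡[n+1]C[k+1] M (suc k) ⟩
  suc M C suc (suc k)                ≡⟨ cong (_C suc (suc k)) N≡1+M ⟨
  N C suc (suc k)                    ∎
  where
  open ≡-Reasoning
  M N : ℕ
  M = suc k + suc k + 1
  N = suc (suc k) + suc (suc k) + 0
  N≡1+M : N ≡ suc M
  N≡1+M = by-ring k
    where by-ring : ∀ k → suc (suc k) + suc (suc k) + 0 ≡ suc (suc k + suc k + 1)
          by-ring = solve-∀
  M-symmetric : M C suc k ≡ M C suc (suc k)
  M-symmetric = subst (λ x → x C suc k ≡ x C suc (suc k)) (by-ring k) (C-symmetric (suc k) (suc (suc k)))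
    where by-ring : ∀ k → suc k + suc (suc k) ≡ suc k + suc k + 1
          by-ring = solve-∀
ballot-binomial (suc k) (suc b) = begin
  ballot (suc (suc k)) (suc (suc b)) + N′ C suc k
    ≡⟨ cong₂ (λ x y → x + y C suc k) (ballot-suc (suc k) (suc b)) N′≡1+N ⟩
  (A + B) + suc N C suc k                ≡⟨ cong ((A + B) +_) (nCk+nC[k+1]≡[n+1]C[k+1] N k) ⟨
  (A + B) + (N C k + N C suc k)          ≡⟨ regroup A B (N C k) (N C suc k) ⟩
  (A + N C suc k) + (B + N C k)          ≡⟨ cong₂ _+_ (ballot-binomial (suc k) b) B-binomial ⟩
  N C suc (suc k) + N C suc k            ≡⟨ +-comm (N C suc (suc k)) _ ⟩
  N C suc k + N C suc (suc k)            ≡⟨ nCk+nC[k+1]≡[n+1]C[k+1] N (suc k) ⟩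
  suc N C suc (suc k)                    ≡⟨ cong (_C suc (suc k)) N′≡1+N ⟨
  N′ C suc (suc k)                       ∎
  where
  open ≡-Reasoning
  N N′ : ℕ
  N  = suc (suc k) + suc (suc k) + b
  N′ = suc (suc k) + suc (suc k) + suc b
  N′≡1+N : N′ ≡ suc N
  N′≡1+N = +-suc (suc (suc k) + suc (suc k)) b
  A B : ℕ
  A = ballot (suc (suc k)) (suc b)
  B = ballot (suc k) (3 + b)
  B-binomial : B + N C k ≡ N C suc k
  B-binomial = subst (λ x → B + x C k ≡ x C suc k) (by-ring k b) (ballot-binomial k (2 + b))
    where by-ring : ∀ k b → suc k + suc k + (2 + b) ≡ suc (suc k) + suc (suc k) + b
          by-ring = solve-∀
  regroup : ∀ a b x y → (a + b) + (x + y) ≡ (a + y) + (b + x)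
  regroup = solve-∀

suc-*-C-suc : ∀ n k → suc k * (suc n C suc k) ≡ suc n * (n C k)
suc-*-C-suc zero zero = refl
suc-*-C-suc zero (suc k) = begin
  suc (suc k) * (1 C suc (suc k)) ≡⟨ cong (suc (suc k) *_) (k>n⇒nCk≡0 {1} {suc (suc k)} (s≤s (s≤s z≤n))) ⟩
  suc (suc k) * 0                 ≡⟨ *-zeroʳ (suc (suc k)) ⟩
  0                               ≡⟨ cong (1 *_) (k>n⇒nCk≡0 {0} {suc k} (s≤s z≤n)) ⟨
  1 * (0 C suc k)                 ∎
  where open ≡-Reasoning
suc-*-C-suc (suc n) zero = trans (+-identityʳ _) (trans (nC1≡n (suc (suc n))) (sym (*-identityʳ (suc (suc n)))))
suc-*-C-suc (suc n) (suc k) = begin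
  suc (suc k) * (suc (suc n) C suc (suc k))    ≡⟨ cong (suc (suc k) *_) (nCk+nC[k+1]≡[n+1]C[k+1] (suc n) (suc k)) ⟨
  suc (suc k) * (X + Y)                        ≡⟨ *-distribˡ-+ (suc (suc k)) X Y ⟩
  (X + suc k * X) + suc (suc k) * Y            ≡⟨ cong₂ (λ x y → (X + x) + y) (suc-*-C-suc n k) (suc-*-C-suc n (suc k)) ⟩
  (X + suc n * (n C k)) + suc n * (n C suc k)  ≡⟨ +-assoc X _ _ ⟩
  X + (suc n * (n C k) + suc n * (n C suc k))  ≡⟨ cong (X +_) (*-distribˡ-+ (suc n) (n C k) (n C suc k)) ⟨
  X + suc n * (n C k + n C suc k)              ≡⟨ cong (λ z → X + suc n * z) (nCk+nC[k+1]≡[n+1]C[k+1] n k) ⟩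
  X + suc n * X                                ∎
  where
  open ≡-Reasoning
  X Y : ℕ
  X = suc n C suc k
  Y = suc n C suc (suc k)

-- This is why m + 1 divides C(2m, m).
C-middle-ratio : ∀ j → suc (suc j) * ((suc j + suc j) C j) ≡ suc j * ((suc j + suc j) C suc j)
C-middle-ratio j = begin
  suc (suc j) * (M C j)           ≡⟨ cong (suc (suc j) *_) M-symmetric ⟩
  suc (suc j) * (M C suc (suc j)) ≡⟨ suc-*-C-suc (j + suc j) (suc j) ⟩
  M * (P C suc j)                 ≡⟨ cong (M *_) (C-symmetric j (suc j)) ⟨
  M * (P C j)                     ≡⟨ suc-*-C-suc (j + suc j) j ⟨
  suc j * (M C suc j)             ∎
  where
  open ≡-Reasoning
  M P : ℕ
  M = suc j + suc j
  P = j + suc j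
  M-symmetric : M C j ≡ M C suc (suc j)
  M-symmetric = subst (λ x → x C j ≡ x C suc (suc j)) (+-suc j (suc j)) (C-symmetric j (suc (suc j)))

catalan≡ballot : ∀ k → catalan k ≡ ballot k 1
catalan≡ballot zero    = refl
catalan≡ballot (suc j) = begin
  d / suc (suc j)             ≡⟨ cong (_/ suc (suc j)) X*[j+2]≡d ⟨
  X * suc (suc j) / suc (suc j) ≡⟨ m*n/n≡m X (suc (suc j)) ⟩
  X                           ∎
  where
  open ≡-Reasoning
  M X c d : ℕ
  M = suc j + suc j
  X = ballot (suc j) 1
  c = M C j
  d = M C suc j
  X+c≡d : X + c ≡ d
  X+c≡d = subst (λ x → X + x C j ≡ x C suc j) (+-identityʳ M) (ballot-binomial j 0)
  X*[j+2]≡d : X * suc (suc j) ≡ d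
  X*[j+2]≡d = +-cancelʳ-≡ (suc j * d) (X * suc (suc j)) d (begin
    X * suc (suc j) + suc j * d       ≡⟨ cong (X * suc (suc j) +_) (C-middle-ratio j) ⟨
    X * suc (suc j) + suc (suc j) * c ≡⟨ cong (_+ suc (suc j) * c) (*-comm X (suc (suc j))) ⟩
    suc (suc j) * X + suc (suc j) * c ≡⟨ *-distribˡ-+ (suc (suc j)) X c ⟨
    suc (suc j) * (X + c)             ≡⟨ cong (suc (suc j) *_) X+c≡d ⟩
    d + suc j * d                     ∎)

punchInℕ : ℕ → ℕ → ℕ
punchInℕ zero    a       = suc a
punchInℕ (suc g) zero    = zero
punchInℕ (suc g) (suc a) = suc (punchInℕ g a)

punchOutℕ : ℕ → ℕ → ℕ
punchOutℕ zero    zero    = zero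
punchOutℕ zero    (suc q) = q
punchOutℕ (suc g) zero    = zero
punchOutℕ (suc g) (suc q) = suc (punchOutℕ g q)

punchInℕ-< : ∀ {g a} → a < g → punchInℕ g a ≡ a
punchInℕ-< {suc g} {zero}  _   = refl
punchInℕ-< {suc g} {suc a} a<g = cong suc (punchInℕ-< (s≤s⁻¹ a<g))

punchInℕ-≥ : ∀ {g a} → g ≤ a → punchInℕ g a ≡ suc a
punchInℕ-≥ {zero}  {a}     _   = refl
punchInℕ-≥ {suc g} {suc a} g≤a = cong suc (punchInℕ-≥ (s≤s⁻¹ g≤a))

punchInℕ≢ : ∀ g a → punchInℕ g a ≢ g
punchInℕ≢ (suc g) (suc a) eq = punchInℕ≢ g a (suc-injective eq)

punchOutℕ-punchInℕ : ∀ g a → punchOutℕ g (punchInℕ g a) ≡ a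
punchOutℕ-punchInℕ zero    a       = refl
punchOutℕ-punchInℕ (suc g) zero    = refl
punchOutℕ-punchInℕ (suc g) (suc a) = cong suc (punchOutℕ-punchInℕ g a)

punchOutℕ-≤ : ∀ {g q} → q ≤ g → punchOutℕ g q ≡ q
punchOutℕ-≤ {zero}  {zero}  _   = refl
punchOutℕ-≤ {suc g} {zero}  _   = refl
punchOutℕ-≤ {suc g} {suc q} q≤g = cong suc (punchOutℕ-≤ (s≤s⁻¹ q≤g))

punchOutℕ-suc : ∀ g → punchOutℕ g (suc g) ≡ g
punchOutℕ-suc zero    = refl
punchOutℕ-suc (suc g) = cong suc (punchOutℕ-suc g)

punchInℕ<⇒<punchOutℕ : ∀ g a q → punchInℕ g a < q → a < punchOutℕ g q
punchInℕ<⇒<punchOutℕ zero    a       (suc q) lt = s≤s⁻¹ lt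
punchInℕ<⇒<punchOutℕ (suc g) zero    (suc q) _  = z<s
punchInℕ<⇒<punchOutℕ (suc g) (suc a) (suc q) lt = s<s (punchInℕ<⇒<punchOutℕ g a q (s≤s⁻¹ lt))

<punchOutℕ⇒punchInℕ< : ∀ g a q → a < punchOutℕ g q → punchInℕ g a < q
<punchOutℕ⇒punchInℕ< zero    a       (suc q) lt = s<s lt
<punchOutℕ⇒punchInℕ< (suc g) zero    (suc q) _  = z<s
<punchOutℕ⇒punchInℕ< (suc g) (suc a) (suc q) lt = s<s (<punchOutℕ⇒punchInℕ< g a q (s≤s⁻¹ lt))

≤punchInℕ⇒punchOutℕ≤ : ∀ g a q → q ≤ punchInℕ g a → punchOutℕ g q ≤ a
≤punchInℕ⇒punchOutℕ≤ g a q q≤ = ≮⇒≥ (λ lt → <⇒≱ (<punchOutℕ⇒punchInℕ< g a q lt) q≤)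

punchOutℕ≤⇒≤punchInℕ : ∀ g a q → punchOutℕ g q ≤ a → q ≤ punchInℕ g a
punchOutℕ≤⇒≤punchInℕ g a q ≤a = ≮⇒≥ (λ lt → <⇒≱ (punchInℕ<⇒<punchOutℕ g a q lt) ≤a)

punchInℕ-mono-< : ∀ g {a c} → a < c → punchInℕ g a < punchInℕ g c
punchInℕ-mono-< g {a} {c} a<c =
  <punchOutℕ⇒punchInℕ< g a _ (subst (a <_) (sym (punchOutℕ-punchInℕ g c)) a<c)

punchInℕ-cancel-< : ∀ g {a c} → punchInℕ g a < punchInℕ g c → a < c
punchInℕ-cancel-< g {a} {c} lt = subst (a <_) (punchOutℕ-punchInℕ g c) (punchInℕ<⇒<punchOutℕ g a _ lt)

punchInℕ-injective : ∀ g {a c} → punchInℕ g a ≡ punchInℕ g c → a ≡ c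
punchInℕ-injective g {a} {c} eq =
  trans (sym (punchOutℕ-punchInℕ g a)) (trans (cong (punchOutℕ g) eq) (punchOutℕ-punchInℕ g c))

punchInℕ<g⇔<g : ∀ g a → (punchInℕ g a < g) ⇔ (a < g)
punchInℕ<g⇔<g g a = mk⇔
  (λ lt → subst (a <_) (punchOutℕ-≤ ≤-refl) (punchInℕ<⇒<punchOutℕ g a g lt))
  (λ lt → <punchOutℕ⇒punchInℕ< g a g (subst (a <_) (sym (punchOutℕ-≤ ≤-refl)) lt))

g<punchInℕ⇔≤ : ∀ g a → (g < punchInℕ g a) ⇔ (g ≤ a)
g<punchInℕ⇔≤ g a = mk⇔
  (λ lt → subst (_≤ a) (punchOutℕ-suc g) (≤punchInℕ⇒punchOutℕ≤ g a (suc g) lt))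
  (λ le → punchOutℕ≤⇒≤punchInℕ g a (suc g) (subst (_≤ a) (sym (punchOutℕ-suc g)) le))

∑<-insert : ∀ N g (f : ℕ → ℕ) → g ≤ N → ∑< (suc N) f ≡ f g + ∑< N (f ∘ punchInℕ g)
∑<-insert N       zero    f _   = refl
∑<-insert (suc N) (suc g) f g≤N = begin
  f 0 + ∑< (suc N) (f ∘ suc)                       ≡⟨ cong (f 0 +_) (∑<-insert N g (f ∘ suc) (s≤s⁻¹ g≤N)) ⟩
  f 0 + (f (suc g) + ∑< N (f ∘ suc ∘ punchInℕ g)) ≡⟨ +-assoc (f 0) _ _ ⟨
  f 0 + f (suc g) + ∑< N (f ∘ suc ∘ punchInℕ g)   ≡⟨ cong (_+ ∑< N (f ∘ suc ∘ punchInℕ g)) (+-comm (f 0) _) ⟩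
  f (suc g) + f 0 + ∑< N (f ∘ suc ∘ punchInℕ g)   ≡⟨ +-assoc (f (suc g)) _ _ ⟩
  f (suc g) + (f 0 + ∑< N (f ∘ suc ∘ punchInℕ g)) ∎
  where open ≡-Reasoning

data Step : Set where
  ascent descent : Step

low high : Step → ℕ → ℕ
low  ascent  j = j
low  descent j = suc j
high ascent  j = suc j
high descent j = j

low≤1+ : ∀ d j → low d j ≤ suc j
low≤1+ ascent  j = n≤1+n j
low≤1+ descent j = ≤-refl

high≤1+ : ∀ d j → high d j ≤ suc j
high≤1+ ascent  j = ≤-refl
high≤1+ descent j = n≤1+n j

direction : ℕ → Step
direction zero          = ascent
direction (suc zero)    = descent
direction (suc (suc p)) = direction p

direction-parity : ∀ p → (Even p × direction p ≡ ascent) ⊎ (¬ Even p × direction p ≡ descent)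
direction-parity zero          = inj₁ (ev0 , refl)
direction-parity (suc zero)    = inj₂ ((λ ()) , refl)
direction-parity (suc (suc p)) with direction-parity p
... | inj₁ (even , eq) = inj₁ (ev2 even , eq)
... | inj₂ (odd , eq)  = inj₂ ((λ { (ev2 even) → odd even }) , eq)

-- An occurrence of 3-14-2 (ascent) or 3-41-2 (descent) in s at positions i, j, j+1, k < n.
Occurs : Step → (ℕ → ℕ) → ℕ → Set
Occurs d s n = Σ ℕ λ i → Σ ℕ λ j → Σ ℕ λ k → k < n × i < j × suc j < k ×
  s (low d j) < s k × s k < s i × s i < s (high d j)

-- Appending the value q (before renumbering) after s would complete an occurrence.
Blocks : Step → (ℕ → ℕ) → ℕ → ℕ → Set
Blocks d s n q = Σ ℕ λ i → Σ ℕ λ j → i < j × suc j < n ×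
  s (low d j) < q × q ≤ s i × s i < s (high d j)

Blocked : (ℕ → ℕ) → ℕ → ℕ → Set
Blocked s n q = Σ Step λ d → Blocks d s n q

Alternating : (ℕ → ℕ) → ℕ → Set
Alternating s n = ∀ p → suc p < n → s (low (direction p) p) < s (high (direction p) p)

InjectiveBelow : (ℕ → ℕ) → ℕ → Set
InjectiveBelow s n = ∀ p r → p < n → r < n → s p ≡ s r → p ≡ r

GoodSeq : (ℕ → ℕ) → ℕ → Set
GoodSeq s n = InjectiveBelow s n × (∀ d → ¬ Occurs d s n) × Alternating s n

StrictlyBetween : ℕ → ℕ → ℕ → Set
StrictlyBetween a b q = (a < q × q < b) ⊎ (b < q × q < a)

-- Appending G after the last value ℓ, with the values ≥ G shifted up, moves in direction d;
-- hence G = ℓ gives a descent.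
Fits : Step → ℕ → ℕ → Set
Fits ascent  ℓ G = ℓ < G
Fits descent ℓ G = G ≤ ℓ

-- Here s has length m + 1 and the gap q ranges over 0 … m + 1.
Site : Step → (ℕ → ℕ) → ℕ → ℕ → Set
Site d s m q = Fits d (s m) q × ¬ Blocked s (suc m) q

occurrence-bounds : ∀ d {i j k} → i < j → suc j < k → i < k × low d j < k × high d j < k
occurrence-bounds d {j = j} i<j sj<k =
  <-trans i<j (<-trans (n<1+n j) sj<k) , ≤-<-trans (low≤1+ d j) sj<k , ≤-<-trans (high≤1+ d j) sj<k

module Append {n : ℕ} {s t : ℕ → ℕ} {G : ℕ}
  (t≡ : ∀ p → p < n → t p ≡ punchInℕ G (s p)) (t-last : t n ≡ G) where

  lift-< : ∀ {p r} → p < n → r < n → s p < s r → t p < t r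
  lift-< {p} {r} p<n r<n lt rewrite t≡ p p<n | t≡ r r<n = punchInℕ-mono-< G lt

  lower-< : ∀ {p r} → p < n → r < n → t p < t r → s p < s r
  lower-< {p} {r} p<n r<n lt rewrite t≡ p p<n | t≡ r r<n = punchInℕ-cancel-< G lt

  lift-<last : ∀ {p} → p < n → s p < G → t p < t n
  lift-<last {p} p<n lt rewrite t≡ p p<n | t-last = from (punchInℕ<g⇔<g G (s p)) lt

  lower-<last : ∀ {p} → p < n → t p < t n → s p < G
  lower-<last {p} p<n lt rewrite t≡ p p<n | t-last = to (punchInℕ<g⇔<g G (s p)) lt

  lift-last< : ∀ {p} → p < n → G ≤ s p → t n < t p
  lift-last< {p} p<n le rewrite t≡ p p<n | t-last = from (g<punchInℕ⇔≤ G (s p)) le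

  lower-last< : ∀ {p} → p < n → t n < t p → G ≤ s p
  lower-last< {p} p<n lt rewrite t≡ p p<n | t-last = to (g<punchInℕ⇔≤ G (s p)) lt

  lift-<gap : ∀ {p} q → p < n → s p < punchOutℕ G q → t p < q
  lift-<gap {p} q p<n lt rewrite t≡ p p<n = <punchOutℕ⇒punchInℕ< G (s p) q lt

  lower-<gap : ∀ {p} q → p < n → t p < q → s p < punchOutℕ G q
  lower-<gap {p} q p<n lt rewrite t≡ p p<n = punchInℕ<⇒<punchOutℕ G (s p) q lt

  lift-gap≤ : ∀ {p} q → p < n → punchOutℕ G q ≤ s p → q ≤ t p
  lift-gap≤ {p} q p<n le rewrite t≡ p p<n = punchOutℕ≤⇒≤punchInℕ G (s p) q le

  lower-gap≤ : ∀ {p} q → p < n → q ≤ t p → punchOutℕ G q ≤ s p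
  lower-gap≤ {p} q p<n le rewrite t≡ p p<n = ≤punchInℕ⇒punchOutℕ≤ G (s p) q le

  occurs-lift : ∀ d → Occurs d s n → Occurs d t (suc n)
  occurs-lift d (i , j , k , k<n , i<j , sj<k , c₁ , c₂ , c₃) with occurrence-bounds d i<j sj<k
  ... | i<k , lo<k , hi<k = i , j , k , m<n⇒m<1+n k<n , i<j , sj<k ,
    lift-< (<-trans lo<k k<n) k<n c₁ , lift-< k<n (<-trans i<k k<n) c₂ , lift-< (<-trans i<k k<n) (<-trans hi<k k<n) c₃

  occurs-lower : ∀ d → Occurs d t (suc n) → Occurs d s n ⊎ Blocks d s n G
  occurs-lower d (i , j , k , k≤n , i<j , sj<k , c₁ , c₂ , c₃) with occurrence-bounds d i<j sj<k | m<1+n⇒m<n∨m≡n k≤n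
  ... | i<k , lo<k , hi<k | inj₁ k<n = inj₁
    (i , j , k , k<n , i<j , sj<k ,
     lower-< (<-trans lo<k k<n) k<n c₁ , lower-< k<n (<-trans i<k k<n) c₂ , lower-< (<-trans i<k k<n) (<-trans hi<k k<n) c₃)
  ... | i<k , lo<k , hi<k | inj₂ refl = inj₂
    (i , j , i<j , sj<k , lower-<last lo<k c₁ , lower-last< i<k c₂ , lower-< i<k hi<k c₃)

  blocks⇒occurs : ∀ d → Blocks d s n G → Occurs d t (suc n)
  blocks⇒occurs d (i , j , i<j , sj<n , c₁ , c₂ , c₃) with occurrence-bounds d i<j sj<n
  ... | i<n , lo<n , hi<n =
    i , j , n , n<1+n n , i<j , sj<n , lift-<last lo<n c₁ , lift-last< i<n c₂ , lift-< i<n hi<n c₃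

  blocks-lift : ∀ d q → Blocks d s n (punchOutℕ G q) → Blocks d t (suc n) q
  blocks-lift d q (i , j , i<j , sj<n , c₁ , c₂ , c₃) with occurrence-bounds d i<j sj<n
  ... | i<n , lo<n , hi<n =
    i , j , i<j , m<n⇒m<1+n sj<n , lift-<gap q lo<n c₁ , lift-gap≤ q i<n c₂ , lift-< i<n hi<n c₃

  alternating-lower : Alternating t (suc n) → Alternating s n
  alternating-lower alt p sp<n =
    lower-< (≤-<-trans (low≤1+ d p) sp<n) (≤-<-trans (high≤1+ d p) sp<n) (alt p (m<n⇒m<1+n sp<n))
    where d : Step
          d = direction p

  injective-lift : InjectiveBelow s n → InjectiveBelow t (suc n)
  injective-lift inj p r p≤n r≤n eq with m<1+n⇒m<n∨m≡n p≤n | m<1+n⇒m<n∨m≡n r≤n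
  ... | inj₁ p<n | inj₁ r<n = inj p r p<n r<n (punchInℕ-injective G (trans (sym (t≡ p p<n)) (trans eq (t≡ r r<n))))
  ... | inj₁ p<n | inj₂ refl = ⊥-elim (punchInℕ≢ G (s p) (trans (sym (t≡ p p<n)) (trans eq t-last)))
  ... | inj₂ refl | inj₁ r<n = ⊥-elim (punchInℕ≢ G (s r) (trans (sym (t≡ r r<n)) (trans (sym eq) t-last)))
  ... | inj₂ refl | inj₂ refl = refl

  injective-lower : InjectiveBelow t (suc n) → InjectiveBelow s n
  injective-lower inj p r p<n r<n eq =
    inj p r (m<n⇒m<1+n p<n) (m<n⇒m<1+n r<n) (trans (t≡ p p<n) (trans (cong (punchInℕ G) eq) (sym (t≡ r r<n))))

module AppendAfter {m : ℕ} {s t : ℕ → ℕ} {G : ℕ}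
  (t≡ : ∀ p → p < suc m → t p ≡ punchInℕ G (s p)) (t-last : t (suc m) ≡ G) where

  open Append t≡ t-last public

  fits-lift : ∀ d → Fits d (s m) G → t (low d m) < t (high d m)
  fits-lift ascent  = lift-<last (n<1+n m)
  fits-lift descent = lift-last< (n<1+n m)

  fits-lower : ∀ d → t (low d m) < t (high d m) → Fits d (s m) G
  fits-lower ascent  = lower-<last (n<1+n m)
  fits-lower descent = lower-last< (n<1+n m)

  alternating-lift : Alternating s (suc m) → Fits (direction m) (s m) G → Alternating t (suc (suc m))
  alternating-lift alt fits p sp≤sm with m<1+n⇒m<n∨m≡n sp≤sm
  ... | inj₁ sp<sm = lift-< (≤-<-trans (low≤1+ d p) sp<sm) (≤-<-trans (high≤1+ d p) sp<sm) (alt p sp<sm)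
    where d : Step
          d = direction p
  ... | inj₂ refl = fits-lift (direction m) fits

  blocks-lower : ∀ d q → Blocks d t (suc (suc m)) q →
                 Blocks d s (suc m) (punchOutℕ G q) ⊎ StrictlyBetween (t m) G q
  blocks-lower d q (i , j , i<j , sj≤sm , c₁ , c₂ , c₃) with m<1+n⇒m<n∨m≡n sj≤sm
  ... | inj₁ sj<sm with occurrence-bounds d i<j sj<sm
  ...   | i<n , lo<n , hi<n =
          inj₁ (i , j , i<j , sj<sm , lower-<gap q lo<n c₁ , lower-gap≤ q i<n c₂ , lower-< i<n hi<n c₃)
  blocks-lower ascent  q (i , j , i<j , _ , c₁ , c₂ , c₃) | inj₂ refl =
    inj₂ (inj₁ (c₁ , ≤-<-trans c₂ (subst (t i <_) t-last c₃)))
  blocks-lower descent q (i , j , i<j , _ , c₁ , c₂ , c₃) | inj₂ refl =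
    inj₂ (inj₂ (subst (_< q) t-last c₁ , ≤-<-trans c₂ c₃))

  before-last : ∀ {p} → p < suc (suc m) → t p ≢ t m → t p ≢ G → p < m
  before-last {p} p<2+m ≢tm ≢G with m<1+n⇒m<n∨m≡n p<2+m
  ... | inj₂ refl = ⊥-elim (≢G t-last)
  ... | inj₁ p<1+m with m<1+n⇒m<n∨m≡n p<1+m
  ...   | inj₁ p<m  = p<m
  ...   | inj₂ refl = ⊥-elim (≢tm refl)

  -- Every value strictly between the last two is taken at some earlier position i, giving the block (i, m).
  between⇒blocked : (∀ v → v < suc (suc m) → Σ ℕ λ p → p < suc (suc m) × t p ≡ v) →
                    (∀ p → p < suc (suc m) → t p < suc (suc m)) →
                    ∀ q → StrictlyBetween (t m) G q → Blocked t (suc (suc m)) q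
  between⇒blocked onto bounded q (inj₁ (tm<q , q<G))
    with onto q (<-trans q<G (subst (_< suc (suc m)) t-last (bounded (suc m) ≤-refl)))
  ... | p , p<2+m , refl = ascent ,
        p , m , before-last p<2+m (>⇒≢ tm<q) (<⇒≢ q<G) , ≤-refl ,
        tm<q , ≤-refl , subst (t p <_) (sym t-last) q<G
  between⇒blocked onto bounded q (inj₂ (G<q , q<tm))
    with onto q (<-trans q<tm (bounded m (m<n⇒m<1+n ≤-refl)))
  ... | p , p<2+m , refl = descent ,
        p , m , before-last p<2+m (<⇒≢ q<tm) (>⇒≢ G<q) , ≤-refl ,
        subst (_< t p) (sym t-last) G<q , ≤-refl , q<tm

  good-lift : GoodSeq s (suc m) → Site (direction m) s m G → GoodSeq t (suc (suc m))
  good-lift (inj , avoids , alt) (fits , unblocked) = injective-lift inj , avoids′ , alternating-lift alt fits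
    where
    avoids′ : ∀ d → ¬ Occurs d t (suc (suc m))
    avoids′ d occ with occurs-lower d occ
    ... | inj₁ occ′  = avoids d occ′
    ... | inj₂ block = unblocked (d , block)

  good-lower : GoodSeq t (suc (suc m)) → GoodSeq s (suc m) × Site (direction m) s m G
  good-lower (inj , avoids , alt) =
    (injective-lower inj , (λ d → avoids d ∘ occurs-lift d) , alternating-lower alt) ,
    fits-lower (direction m) (alt m ≤-refl) , λ { (d , block) → avoids d (blocks⇒occurs d block) }

Blocks? : ∀ d s n q → Dec (Blocks d s n q)
Blocks? d s n q = map′ reshape unshape (anyUpTo? (λ j → anyUpTo? (witness? j) j) n)
  where
  Witness : ℕ → ℕ → Set
  Witness j i = suc j < n × s (low d j) < q × q ≤ s i × s i < s (high d j)
  witness? : ∀ j i → Dec (Witness j i)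
  witness? j i = (suc j <? n) ×-dec (s (low d j) <? q) ×-dec (q ≤? s i) ×-dec (s i <? s (high d j))
  reshape : (Σ ℕ λ j → j < n × Σ ℕ λ i → i < j × Witness j i) → Blocks d s n q
  reshape (j , _ , i , i<j , w) = i , j , i<j , w
  unshape : Blocks d s n q → (Σ ℕ λ j → j < n × Σ ℕ λ i → i < j × Witness j i)
  unshape (i , j , i<j , w@(sj<n , _)) = j , <-trans (n<1+n j) sj<n , i , i<j , w

Blocked? : ∀ s n q → Dec (Blocked s n q)
Blocked? s n q = map′ (λ { (inj₁ b) → ascent , b ; (inj₂ b) → descent , b })
                      (λ { (ascent , b) → inj₁ b ; (descent , b) → inj₂ b })
                      (Blocks? ascent s n q ⊎-dec Blocks? descent s n q)

Fits? : ∀ d ℓ G → Dec (Fits d ℓ G)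
Fits? ascent  ℓ G = ℓ <? G
Fits? descent ℓ G = G ≤? ℓ

Site? : ∀ d s m q → Dec (Site d s m q)
Site? d s m q = Fits? d (s m) q ×-dec ¬? (Blocked? s (suc m) q)

last-unblocked : ∀ {s m} → GoodSeq s (suc m) → ¬ Blocked s (suc m) (s m)
last-unblocked {s} {m} (inj , avoids , _) (d , i , j , i<j , sj<sm , c₁ , c₂ , c₃) with m<1+n⇒m<n∨m≡n sj<sm
last-unblocked _ (ascent  , _ , _ , _ , _ , _  , c₂ , c₃) | inj₂ refl = <-irrefl refl (<-≤-trans c₃ c₂)
last-unblocked _ (descent , _ , _ , _ , _ , c₁ , _  , _ ) | inj₂ refl = <-irrefl refl c₁
... | inj₁ sj<m = avoids d (i , j , m , ≤-refl , i<j , sj<m , c₁ , sm<si , c₃)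
  where
  i<m : i < m
  i<m = <-trans i<j (<-trans (n<1+n j) sj<m)
  sm<si : s m < s i
  sm<si = ≤∧≢⇒< c₂ (λ sm≡si → <-irrefl (inj i m (m<n⇒m<1+n i<m) ≤-refl (sym sm≡si)) i<m)

label : Step → (ℕ → ℕ) → ℕ → ℕ
label d s m = count (Site? d s m) (suc (suc m))

module ChildLabels {m : ℕ} {s t : ℕ → ℕ} {G : ℕ}
  (t≡ : ∀ p → p < suc m → t p ≡ punchInℕ G (s p)) (t-last : t (suc m) ≡ G)
  (onto : ∀ v → v < suc (suc m) → Σ ℕ λ p → p < suc (suc m) × t p ≡ v)
  (t-bounded : ∀ p → p < suc (suc m) → t p < suc (suc m))
  (good : GoodSeq s (suc m)) (G-unblocked : ¬ Blocked s (suc m) G) where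

  open AppendAfter t≡ t-last

  ℓ : ℕ
  ℓ = s m

  tm≡ : t m ≡ punchInℕ G ℓ
  tm≡ = t≡ m ≤-refl

  G<2+m : G < suc (suc m)
  G<2+m = subst (_< suc (suc m)) t-last (t-bounded (suc m) ≤-refl)

  unblocked-punchIn⇔ : ∀ q → (¬ Blocked t (suc (suc m)) (punchInℕ G q)) ⇔
                       (¬ Blocked s (suc m) q × ¬ StrictlyBetween (t m) G (punchInℕ G q))
  unblocked-punchIn⇔ q = mk⇔
    (λ free → free ∘ lift ∘ subst (Blocked s (suc m)) (sym (punchOutℕ-punchInℕ G q)) ,
              free ∘ between⇒blocked onto t-bounded (punchInℕ G q))
    (λ { (free , ¬between) (d , block) → case blocks-lower d (punchInℕ G q) block of λ where
           (inj₁ block′)  → free (d , subst (Blocks d s (suc m)) (punchOutℕ-punchInℕ G q) block′)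
           (inj₂ between) → ¬between between })
    where
    lift : ∀ {q′} → Blocked s (suc m) (punchOutℕ G q′) → Blocked t (suc (suc m)) q′
    lift {q′} (d , block) = d , blocks-lift d q′ block

  G-free : ¬ Blocked t (suc (suc m)) G
  G-free (d , block) with blocks-lower d G block
  ... | inj₁ block′ = G-unblocked (d , subst (Blocks d s (suc m)) (punchOutℕ-≤ ≤-refl) block′)
  ... | inj₂ (inj₁ (_ , G<G)) = <-irrefl refl G<G
  ... | inj₂ (inj₂ (G<G , _)) = <-irrefl refl G<G

  label-insert : ∀ d → label d t (suc m) ≡ ⟦ Site? d t (suc m) G ⟧ + count (Site? d t (suc m) ∘ punchInℕ G) (suc (suc m))
  label-insert d = ∑<-insert (suc (suc m)) G (λ q → ⟦ Site? d t (suc m) q ⟧) (<⇒≤ G<2+m)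

  descent-site-G : Site descent t (suc m) G
  descent-site-G = ≤-reflexive (sym t-last) , G-free

  ¬ascent-site-G : ¬ Site ascent t (suc m) G
  ¬ascent-site-G (t<G , _) = <-irrefl t-last t<G

  punchInℕ≤G⇒< : ∀ {q} → punchInℕ G q ≤ t (suc m) → q < G
  punchInℕ≤G⇒< {q} le = to (punchInℕ<g⇔<g G q) (≤∧≢⇒< (subst (punchInℕ G q ≤_) t-last le) (punchInℕ≢ G q))

  module Peak (ℓ<G : ℓ < G) where

    tm≡ℓ : t m ≡ ℓ
    tm≡ℓ = trans tm≡ (punchInℕ-< ℓ<G)

    descent-site⇔ : ∀ q → Site descent t (suc m) (punchInℕ G q) ⇔ Site descent s m q
    descent-site⇔ q = mk⇔
      (λ (le , free) → let q<G = punchInℕ≤G⇒< le in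
        ≮⇒≥ (λ ℓ<q → proj₂ (to (unblocked-punchIn⇔ q) free)
                        (inj₁ (subst₂ _<_ (sym tm≡ℓ) (sym (punchInℕ-< q<G)) ℓ<q ,
                               subst (_< G) (sym (punchInℕ-< q<G)) q<G))) ,
        proj₁ (to (unblocked-punchIn⇔ q) free))
      (λ (q≤ℓ , free) → let q<G = ≤-<-trans q≤ℓ ℓ<G ; pq≡q = punchInℕ-< q<G in
        subst₂ _≤_ (sym pq≡q) (sym t-last) (<⇒≤ q<G) ,
        from (unblocked-punchIn⇔ q) (free , λ where
          (inj₁ (tm<pq , _)) → <⇒≱ (subst₂ _<_ tm≡ℓ pq≡q tm<pq) q≤ℓ
          (inj₂ (G<pq , _))  → <-asym q<G (subst (G <_) pq≡q G<pq)))

    ascent-site⇔ : ∀ q → Site ascent t (suc m) (punchInℕ G q) ⇔ (G ≤ q × Site ascent s m q)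
    ascent-site⇔ q = mk⇔
      (λ (t<pq , free) → let G≤q = to (g<punchInℕ⇔≤ G q) (subst (_< punchInℕ G q) t-last t<pq) in
        G≤q , <-≤-trans ℓ<G G≤q , proj₁ (to (unblocked-punchIn⇔ q) free))
      (λ (G≤q , _ , free) → let G<pq = from (g<punchInℕ⇔≤ G q) G≤q in
        subst (_< punchInℕ G q) (sym t-last) G<pq ,
        from (unblocked-punchIn⇔ q) (free , λ where
          (inj₁ (_ , pq<G))  → <-asym G<pq pq<G
          (inj₂ (_ , pq<tm)) → <-asym (<-trans ℓ<G G<pq) (subst (punchInℕ G q <_) tm≡ℓ pq<tm)))

    label-descent : label descent t (suc m) ≡ suc (label descent s m)
    label-descent = trans (label-insert descent)
      (cong₂ _+_ (when-yes 1 descent-site-G (Site? descent t (suc m) G))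
                 (count-cong (Site? descent t (suc m) ∘ punchInℕ G) (Site? descent s m) descent-site⇔ (suc (suc m))))

    label-ascent : label ascent t (suc m) ≡ countFrom (Site? ascent s m) (suc (suc m)) G
    label-ascent = trans (label-insert ascent)
      (cong₂ _+_ (when-no 1 ¬ascent-site-G (Site? ascent t (suc m) G))
                 (count-cong (Site? ascent t (suc m) ∘ punchInℕ G) (λ q → G ≤? q ×-dec Site? ascent s m q) ascent-site⇔ (suc (suc m))))

  module Valley (G≤ℓ : G ≤ ℓ) where

    tm≡1+ℓ : t m ≡ suc ℓ
    tm≡1+ℓ = trans tm≡ (punchInℕ-≥ G≤ℓ)

    descent-site⇔ : ∀ q → Site descent t (suc m) (punchInℕ G q) ⇔ (q < G × Site descent s m q)
    descent-site⇔ q = mk⇔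
      (λ (le , free) → let q<G = punchInℕ≤G⇒< le in
        q<G , ≤-trans (<⇒≤ q<G) G≤ℓ , proj₁ (to (unblocked-punchIn⇔ q) free))
      (λ (q<G , _ , free) → let pq≡q = punchInℕ-< q<G in
        subst₂ _≤_ (sym pq≡q) (sym t-last) (<⇒≤ q<G) ,
        from (unblocked-punchIn⇔ q) (free , λ where
          (inj₁ (tm<pq , _)) → <-asym (subst₂ _<_ tm≡1+ℓ pq≡q tm<pq) (<-≤-trans q<G (m≤n⇒m≤1+n G≤ℓ))
          (inj₂ (G<pq , _))  → <-asym q<G (subst (G <_) pq≡q G<pq)))

    ascent-site⇔ : ∀ q → Site ascent t (suc m) (punchInℕ G q) ⇔ (ℓ ≤ q × ¬ Blocked s (suc m) q)
    ascent-site⇔ q = mk⇔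
      (λ (t<pq , free) → let G≤q = to (g<punchInℕ⇔≤ G q) (subst (_< punchInℕ G q) t-last t<pq)
                             pq≡1+q = punchInℕ-≥ G≤q in
        ≮⇒≥ (λ q<ℓ → proj₂ (to (unblocked-punchIn⇔ q) free)
                        (inj₂ (subst (_< punchInℕ G q) t-last t<pq , subst₂ _<_ (sym pq≡1+q) (sym tm≡1+ℓ) (s<s q<ℓ)))) ,
        proj₁ (to (unblocked-punchIn⇔ q) free))
      (λ (ℓ≤q , free) → let G<pq = from (g<punchInℕ⇔≤ G q) (≤-trans G≤ℓ ℓ≤q) in
        subst (_< punchInℕ G q) (sym t-last) G<pq ,
        from (unblocked-punchIn⇔ q) (free , λ where
          (inj₁ (_ , pq<G))  → <-asym G<pq pq<G
          (inj₂ (_ , pq<tm)) → <⇒≱ (subst₂ _<_ (punchInℕ-≥ (≤-trans G≤ℓ ℓ≤q)) tm≡1+ℓ pq<tm) (s≤s ℓ≤q)))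

    label-descent : label descent t (suc m) ≡ suc (count (Site? descent s m) G)
    label-descent = trans (label-insert descent)
      (cong₂ _+_ (when-yes 1 descent-site-G (Site? descent t (suc m) G))
                 (trans (count-cong (Site? descent t (suc m) ∘ punchInℕ G) (λ q → q <? G ×-dec Site? descent s m q)
                                    descent-site⇔ (suc (suc m)))
                        (count-below (Site? descent s m) (suc (suc m)) G (<⇒≤ G<2+m))))

    label-ascent : label ascent t (suc m) ≡ suc (label ascent s m)
    label-ascent = trans (label-insert ascent)
      (cong₂ _+_ (when-no 1 ¬ascent-site-G (Site? ascent t (suc m) G))
        (trans (count-cong (Site? ascent t (suc m) ∘ punchInℕ G) (λ q → ℓ ≤? q ×-dec ¬? (Blocked? s (suc m) q))
                           ascent-site⇔ (suc (suc m)))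
          (trans (countFrom-split (¬? ∘ Blocked? s (suc m)) (suc (suc m)) ℓ ℓ<2+m)
                 (cong (_+ label ascent s m) (when-yes 1 (last-unblocked good) (¬? (Blocked? s (suc m) ℓ)))))))
      where
      ℓ<2+m : ℓ < suc (suc m)
      ℓ<2+m = <-trans (n<1+n ℓ) (subst (_< suc (suc m)) tm≡1+ℓ (t-bounded m (m<n⇒m<1+n ≤-refl)))

injective⇒surjective : ∀ {n} (f : Fin n → Fin n) → Injective _≡_ _≡_ f → ∀ v → Σ (Fin n) λ p → f p ≡ v
injective⇒surjective f inj v with any? (λ p → f p ≟ᶠ v)
... | yes hit = hit
injective⇒surjective {suc n} f inj v | no miss with pigeonhole (n<1+n n) (λ p → punchOut (miss ∘ (p ,_) ∘ sym))
... | i , j , i<j , eq = ⊥-elim (<-irrefl (cong toℕ (inj (punchOut-injective (miss ∘ (i ,_) ∘ sym) (miss ∘ (j ,_) ∘ sym) eq))) i<j)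

seq : ∀ {k n} → Vec (Fin k) n → ℕ → ℕ
seq []       p       = 0
seq (x ∷ xs) zero    = toℕ x
seq (x ∷ xs) (suc p) = seq xs p

seq-lookup : ∀ {k n} (σ : Vec (Fin k) n) (p : Fin n) → seq σ (toℕ p) ≡ toℕ (lookup σ p)
seq-lookup (x ∷ xs) zero    = refl
seq-lookup (x ∷ xs) (suc p) = seq-lookup xs p

seq-fromℕ< : ∀ {k n} (σ : Vec (Fin k) n) {p} (p<n : p < n) → seq σ p ≡ toℕ (lookup σ (fromℕ< p<n))
seq-fromℕ< σ p<n = trans (cong (seq σ) (sym (toℕ-fromℕ< p<n))) (seq-lookup σ (fromℕ< p<n))

seq-bounded : ∀ {k n} (σ : Vec (Fin k) n) {p} → p < n → seq σ p < k
seq-bounded (x ∷ xs) {zero}  _   = toℕ<n x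
seq-bounded (x ∷ xs) {suc p} p<n = seq-bounded xs (s≤s⁻¹ p<n)

seq-injective : ∀ {k n} (u v : Vec (Fin k) n) → (∀ p → p < n → seq u p ≡ seq v p) → u ≡ v
seq-injective []       []       _  = refl
seq-injective (x ∷ u) (y ∷ v) eq = cong₂ _∷_ (toℕ-injective (eq 0 z<s)) (seq-injective u v (λ p p<n → eq (suc p) (s<s p<n)))

lookup<⇒seq< : ∀ {k n} (σ : Vec (Fin k) n) {p r} → lookup σ p <ᶠ lookup σ r → seq σ (toℕ p) < seq σ (toℕ r)
lookup<⇒seq< σ {p} {r} = subst₂ _<_ (sym (seq-lookup σ p)) (sym (seq-lookup σ r))

seq<⇒lookup< : ∀ {k n} (σ : Vec (Fin k) n) {p r} (p<n : p < n) (r<n : r < n) →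
               seq σ p < seq σ r → lookup σ (fromℕ< p<n) <ᶠ lookup σ (fromℕ< r<n)
seq<⇒lookup< σ p<n r<n = subst₂ _<_ (seq-fromℕ< σ p<n) (seq-fromℕ< σ r<n)

fromℕ<-mono-< : ∀ {n p r} (p<n : p < n) (r<n : r < n) → p < r → fromℕ< p<n <ᶠ fromℕ< r<n
fromℕ<-mono-< p<n r<n = subst₂ _<_ (sym (toℕ-fromℕ< p<n)) (sym (toℕ-fromℕ< r<n))

toℕ-fromℕ<-suc : ∀ {n j} (j<n : j < n) (sj<n : suc j < n) → toℕ (fromℕ< sj<n) ≡ suc (toℕ (fromℕ< j<n))
toℕ-fromℕ<-suc j<n sj<n = trans (toℕ-fromℕ< sj<n) (cong suc (sym (toℕ-fromℕ< j<n)))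

module _ {n : ℕ} (σ : Vec (Fin n) n) where

  3-14-2⇒occurs : Contains3-14-2 σ → Occurs ascent (seq σ) n
  3-14-2⇒occurs (i , j , j′ , k , i<j , j′≡1+j , j′<k , c₁ , c₂ , c₃) =
    toℕ i , toℕ j , toℕ k , toℕ<n k , i<j , subst (_< toℕ k) j′≡1+j j′<k ,
    lookup<⇒seq< σ c₁ , lookup<⇒seq< σ c₂ , subst (λ x → seq σ (toℕ i) < seq σ x) j′≡1+j (lookup<⇒seq< σ c₃)

  3-41-2⇒occurs : Contains3-41-2 σ → Occurs descent (seq σ) n
  3-41-2⇒occurs (i , j , j′ , k , i<j , j′≡1+j , j′<k , c₁ , c₂ , c₃) =
    toℕ i , toℕ j , toℕ k , toℕ<n k , i<j , subst (_< toℕ k) j′≡1+j j′<k ,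
    subst (λ x → seq σ x < seq σ (toℕ k)) j′≡1+j (lookup<⇒seq< σ c₁) , lookup<⇒seq< σ c₂ , lookup<⇒seq< σ c₃

  occurs⇒3-14-2 : Occurs ascent (seq σ) n → Contains3-14-2 σ
  occurs⇒3-14-2 (i , j , k , k<n , i<j , sj<k , c₁ , c₂ , c₃) =
    fromℕ< i<n , fromℕ< j<n , fromℕ< sj<n , fromℕ< k<n ,
    fromℕ<-mono-< i<n j<n i<j , toℕ-fromℕ<-suc j<n sj<n , fromℕ<-mono-< sj<n k<n sj<k ,
    seq<⇒lookup< σ j<n k<n c₁ , seq<⇒lookup< σ k<n i<n c₂ , seq<⇒lookup< σ i<n sj<n c₃
    where
    sj<n : suc j < n
    sj<n = <-trans sj<k k<n
    j<n : j < n
    j<n = <-trans (n<1+n j) sj<n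
    i<n : i < n
    i<n = <-trans i<j j<n

  occurs⇒3-41-2 : Occurs descent (seq σ) n → Contains3-41-2 σ
  occurs⇒3-41-2 (i , j , k , k<n , i<j , sj<k , c₁ , c₂ , c₃) =
    fromℕ< i<n , fromℕ< j<n , fromℕ< sj<n , fromℕ< k<n ,
    fromℕ<-mono-< i<n j<n i<j , toℕ-fromℕ<-suc j<n sj<n , fromℕ<-mono-< sj<n k<n sj<k ,
    seq<⇒lookup< σ sj<n k<n c₁ , seq<⇒lookup< σ k<n i<n c₂ , seq<⇒lookup< σ i<n j<n c₃
    where
    sj<n : suc j < n
    sj<n = <-trans sj<k k<n
    j<n : j < n
    j<n = <-trans (n<1+n j) sj<n
    i<n : i < n
    i<n = <-trans i<j j<n

  isPerm⇒injective : IsPerm σ → InjectiveBelow (seq σ) n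
  isPerm⇒injective perm p r p<n r<n eq =
    trans (sym (toℕ-fromℕ< p<n))
      (trans (cong toℕ (perm (toℕ-injective (trans (sym (seq-fromℕ< σ p<n)) (trans eq (seq-fromℕ< σ r<n))))))
        (toℕ-fromℕ< r<n))

  injective⇒isPerm : InjectiveBelow (seq σ) n → IsPerm σ
  injective⇒isPerm inj {p} {r} eq = toℕ-injective (inj (toℕ p) (toℕ r) (toℕ<n p) (toℕ<n r)
    (trans (seq-lookup σ p) (trans (cong toℕ eq) (sym (seq-lookup σ r)))))

  altAscent⇒alternating : AltAscent σ → Alternating (seq σ) n
  altAscent⇒alternating alt p sp<n with direction-parity p
  ... | inj₁ (even , eq) rewrite eq =
    subst₂ _<_ (sym (seq-fromℕ< σ p<n)) (sym (seq-fromℕ< σ sp<n))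
      (proj₁ (alt (fromℕ< p<n) (fromℕ< sp<n) (toℕ-fromℕ<-suc p<n sp<n)) (subst Even (sym (toℕ-fromℕ< p<n)) even))
    where p<n : p < n
          p<n = <-trans (n<1+n p) sp<n
  ... | inj₂ (odd , eq) rewrite eq =
    subst₂ _<_ (sym (seq-fromℕ< σ sp<n)) (sym (seq-fromℕ< σ p<n))
      (proj₂ (alt (fromℕ< p<n) (fromℕ< sp<n) (toℕ-fromℕ<-suc p<n sp<n)) (odd ∘ subst Even (toℕ-fromℕ< p<n)))
    where p<n : p < n
          p<n = <-trans (n<1+n p) sp<n

  alternating⇒altAscent : Alternating (seq σ) n → AltAscent σ
  alternating⇒altAscent alt p q q≡1+p with direction-parity (toℕ p) | alt (toℕ p) (subst (_< n) q≡1+p (toℕ<n q))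
  ... | inj₁ (even , eq) | lt rewrite eq =
    (λ _ → subst₂ _<_ (seq-lookup σ p) (trans (cong (seq σ) (sym q≡1+p)) (seq-lookup σ q)) lt) , (λ odd → ⊥-elim (odd even))
  ... | inj₂ (odd , eq) | lt rewrite eq =
    (λ even → ⊥-elim (odd even)) , (λ _ → subst₂ _<_ (trans (cong (seq σ) (sym q≡1+p)) (seq-lookup σ q)) (seq-lookup σ p) lt)

  good⇒goodSeq : Good σ → GoodSeq (seq σ) n
  good⇒goodSeq (perm , no3-14-2 , no3-41-2 , alt) =
    isPerm⇒injective perm , avoids , altAscent⇒alternating alt
    where
    avoids : ∀ d → ¬ Occurs d (seq σ) n
    avoids ascent  = no3-14-2 ∘ occurs⇒3-14-2
    avoids descent = no3-41-2 ∘ occurs⇒3-41-2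

  goodSeq⇒good : GoodSeq (seq σ) n → Good σ
  goodSeq⇒good (inj , avoids , alt) =
    injective⇒isPerm inj , avoids ascent ∘ 3-14-2⇒occurs , avoids descent ∘ 3-41-2⇒occurs , alternating⇒altAscent alt

  seq-onto : IsPerm σ → ∀ v → v < n → Σ ℕ λ p → p < n × seq σ p ≡ v
  seq-onto perm v v<n with injective⇒surjective (lookup σ) perm (fromℕ< v<n)
  ... | p , eq = toℕ p , toℕ<n p , trans (seq-lookup σ p) (trans (cong toℕ eq) (toℕ-fromℕ< v<n))

toℕ-punchIn : ∀ {k} (g : Fin (suc k)) (a : Fin k) → toℕ (punchIn g a) ≡ punchInℕ (toℕ g) (toℕ a)
toℕ-punchIn zero    a       = refl
toℕ-punchIn (suc g) zero    = refl
toℕ-punchIn (suc g) (suc a) = cong suc (toℕ-punchIn g a)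

seq-map-punchIn : ∀ {k n} (g : Fin (suc k)) (xs : Vec (Fin k) n) p → p < n →
                  seq (map (punchIn g) xs) p ≡ punchInℕ (toℕ g) (seq xs p)
seq-map-punchIn g (y ∷ xs) zero    _   = toℕ-punchIn g y
seq-map-punchIn g (y ∷ xs) (suc p) p<n = seq-map-punchIn g xs p (s≤s⁻¹ p<n)

seq-∷ʳ-init : ∀ {k n} (xs : Vec (Fin k) n) x p → p < n → seq (xs ∷ʳ x) p ≡ seq xs p
seq-∷ʳ-init (y ∷ xs) x zero    _   = refl
seq-∷ʳ-init (y ∷ xs) x (suc p) p<n = seq-∷ʳ-init xs x p (s≤s⁻¹ p<n)

seq-∷ʳ-last : ∀ {k n} (xs : Vec (Fin k) n) x → seq (xs ∷ʳ x) n ≡ toℕ x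
seq-∷ʳ-last []       x = refl
seq-∷ʳ-last (y ∷ xs) x = seq-∷ʳ-last xs x

append : ∀ {n} → Vec (Fin n) n → Fin (suc n) → Vec (Fin (suc n)) (suc n)
append σ g = map (punchIn g) σ ∷ʳ g

seq-append-init : ∀ {n} (σ : Vec (Fin n) n) g p → p < n → seq (append σ g) p ≡ punchInℕ (toℕ g) (seq σ p)
seq-append-init σ g p p<n = trans (seq-∷ʳ-init (map (punchIn g) σ) g p p<n) (seq-map-punchIn g σ p p<n)

seq-append-last : ∀ {n} (σ : Vec (Fin n) n) g → seq (append σ g) n ≡ toℕ g
seq-append-last σ g = seq-∷ʳ-last (map (punchIn g) σ) g

append-injective : ∀ {n} (σ σ′ : Vec (Fin n) n) g g′ → append σ g ≡ append σ′ g′ → σ ≡ σ′ × g ≡ g′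
append-injective σ σ′ g g′ eq with ∷ʳ-injective (map (punchIn g) σ) (map (punchIn g′) σ′) eq
... | init≡ , refl = seq-injective σ σ′ (λ p p<n → punchInℕ-injective (toℕ g)
      (trans (sym (seq-map-punchIn g σ p p<n)) (trans (cong (λ v → seq v p) init≡) (seq-map-punchIn g σ′ p p<n)))) , refl

punchOutAll : ∀ {k n} (x : Fin (suc k)) (xs : Vec (Fin (suc k)) n) → (∀ p → p < n → seq xs p ≢ toℕ x) → Vec (Fin k) n
punchOutAll x []       _     = []
punchOutAll x (y ∷ ys) avoid =
  punchOut {i = x} {j = y} (avoid 0 z<s ∘ cong toℕ ∘ sym) ∷ punchOutAll x ys (λ p p<n → avoid (suc p) (s<s p<n))

map-punchIn-punchOutAll : ∀ {k n} (x : Fin (suc k)) (xs : Vec (Fin (suc k)) n) avoid →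
                          map (punchIn x) (punchOutAll x xs avoid) ≡ xs
map-punchIn-punchOutAll x []       _     = refl
map-punchIn-punchOutAll x (y ∷ ys) avoid = cong₂ _∷_ (punchIn-punchOut _) (map-punchIn-punchOutAll x ys _)

append-surjective : ∀ {n} (τ : Vec (Fin (suc n)) (suc n)) → IsPerm τ → Σ (Vec (Fin n) n) λ σ → Σ (Fin (suc n)) λ g → τ ≡ append σ g
append-surjective {n} τ perm with initLast τ
... | xs , x , refl = punchOutAll x xs avoid , x , cong (_∷ʳ x) (sym (map-punchIn-punchOutAll x xs avoid))
  where
  avoid : ∀ p → p < n → seq xs p ≢ toℕ x
  avoid p p<n eq = <-irrefl (isPerm⇒injective (xs ∷ʳ x) perm p n (m<n⇒m<1+n p<n) ≤-refl
    (trans (seq-∷ʳ-init xs x p p<n) (trans eq (sym (seq-∷ʳ-last xs x))))) p<n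

append-isPerm : ∀ {n} (σ : Vec (Fin n) n) g → IsPerm σ → IsPerm (append σ g)
append-isPerm σ g perm = injective⇒isPerm (append σ g)
  (Append.injective-lift (seq-append-init σ g) (seq-append-last σ g) (isPerm⇒injective σ perm))

good-append : ∀ {m} (σ : Vec (Fin (suc m)) (suc m)) g →
              Good σ → Site (direction m) (seq σ) m (toℕ g) → Good (append σ g)
good-append σ g good site = goodSeq⇒good (append σ g)
  (AppendAfter.good-lift (seq-append-init σ g) (seq-append-last σ g) (good⇒goodSeq σ good) site)

good-append⁻ : ∀ {m} (σ : Vec (Fin (suc m)) (suc m)) g →
               Good (append σ g) → Good σ × Site (direction m) (seq σ) m (toℕ g)
good-append⁻ σ g good with AppendAfter.good-lower (seq-append-init σ g) (seq-append-last σ g) (good⇒goodSeq (append σ g) good)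
... | goodσ , site = goodSeq⇒good σ goodσ , site

good-singleton : Good (zero ∷ [])
good-singleton = (λ { {zero} {zero} _ → refl }) , (λ { (_ , _ , _ , zero , _ , _ , ()) }) ,
                 (λ { (_ , _ , _ , zero , _ , _ , ()) }) , (λ { zero zero () })

sites : ∀ {m} → Step → Vec (Fin (suc m)) (suc m) → List (Fin (suc (suc m)))
sites {m} d σ = filter (Site? d (seq σ) m ∘ toℕ) (allFin (suc (suc m)))

children : ∀ {m} → Vec (Fin (suc m)) (suc m) → List (Vec (Fin (suc (suc m))) (suc (suc m)))
children {m} σ = mapL (append σ) (sites (direction m) σ)

goods : (m : ℕ) → List (Vec (Fin (suc m)) (suc m))
goods zero    = [ zero ∷ [] ]
goods (suc m) = concatMap children (goods m)

site∈sites : ∀ {m} d (σ : Vec (Fin (suc m)) (suc m)) {g} → g ∈ sites d σ → Site d (seq σ) m (toℕ g)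
site∈sites {m} d σ = proj₂ ∘ ∈-filter⁻ (Site? d (seq σ) m ∘ toℕ)

goods-sound : ∀ m {τ} → τ ∈ goods m → Good τ
goods-sound zero    (here refl) = good-singleton
goods-sound (suc m) τ∈ with find (∈-concatMap⁻ children {xs = goods m} τ∈)
... | σ , σ∈ , τ∈children with ∈-map⁻ (append σ) τ∈children
...   | g , g∈ , refl = good-append σ g (goods-sound m σ∈) (site∈sites (direction m) σ g∈)

goods-complete : ∀ m {τ} → Good τ → τ ∈ goods m
goods-complete zero {zero ∷ []} _ = here refl
goods-complete (suc m) {τ} good with append-surjective τ (proj₁ good)
... | σ , g , refl with good-append⁻ σ g good
...   | goodσ , site = ∈-concatMap⁺ children (lose (goods-complete m goodσ)
        (∈-map⁺ (append σ) (∈-filter⁺ (Site? (direction m) (seq σ) m ∘ toℕ) (∈-allFin g) site)))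

children-unique : ∀ {m} (σ : Vec (Fin (suc m)) (suc m)) → Unique (children σ)
children-unique {m} σ = map⁺ (proj₂ ∘ append-injective σ σ _ _) (filter⁺ (Site? (direction m) (seq σ) m ∘ toℕ) (allFin⁺ (suc (suc m))))

children-disjoint : ∀ {m} {σ σ′ : Vec (Fin (suc m)) (suc m)} → σ ≢ σ′ → Disjoint (children σ) (children σ′)
children-disjoint {σ = σ} {σ′} σ≢σ′ (τ∈ , τ∈′) with ∈-map⁻ (append σ) τ∈ | ∈-map⁻ (append σ′) τ∈′
... | g , _ , refl | g′ , _ , eq = σ≢σ′ (proj₁ (append-injective σ σ′ g g′ eq))

goods-unique : ∀ m → Unique (goods m)
goods-unique zero    = All.[] AllPairs.∷ AllPairs.[]
goods-unique (suc m) = concat⁺ (Allₚ.map⁺ (All.universal children-unique (goods m)))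
                               (AllPairsₚ.map⁺ (AllPairs.map children-disjoint (goods-unique m)))

weight : (ℕ → ℕ → ℕ) → ∀ {m} → Vec (Fin (suc m)) (suc m) → ℕ
weight F {m} σ = F (label descent (seq σ) m) (label ascent (seq σ) m)

grow : Step → (ℕ → ℕ → ℕ) → ℕ → ℕ → ℕ
grow ascent  F a b = ∑< b (λ i → F (suc a) (suc i))
grow descent F a b = ∑< a (λ i → F (suc i) (suc b))

sum-filter : ∀ {A : Set} {P : A → Set} (P? : ∀ x → Dec (P x)) (h : A → ℕ) xs →
             sum (mapL h (filter P? xs)) ≡ sum (mapL (λ x → h x when P? x) xs)
sum-filter P? h []       = refl
sum-filter P? h (x ∷ xs) with P? x
... | yes _ = cong (h x +_) (sum-filter P? h xs)
... | no _  = sum-filter P? h xs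

sum-tabulate : ∀ N (f : ℕ → ℕ) → sum (tabulate {n = N} (f ∘ toℕ)) ≡ ∑< N f
sum-tabulate zero    f = refl
sum-tabulate (suc N) f = cong (f 0 +_) (sum-tabulate N (f ∘ suc))

sum-allFin : ∀ N (f : ℕ → ℕ) → sum (mapL (f ∘ toℕ) (allFin N)) ≡ ∑< N f
sum-allFin N f = trans (cong sum (map-tabulate {n = N} (λ i → i) (f ∘ toℕ))) (sum-tabulate N f)

sum-concatMap : ∀ {A B : Set} (f : A → List B) (h : B → ℕ) xs →
                sum (mapL h (concatMap f xs)) ≡ sum (mapL (sum ∘ mapL h ∘ f) xs)
sum-concatMap f h []       = refl
sum-concatMap f h (x ∷ xs) = begin
  sum (mapL h (f x ++ concatMap f xs))            ≡⟨ cong sum (map-++ h (f x) (concatMap f xs)) ⟩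
  sum (mapL h (f x) ++ mapL h (concatMap f xs))   ≡⟨ sum-++ (mapL h (f x)) _ ⟩
  sum (mapL h (f x)) + sum (mapL h (concatMap f xs)) ≡⟨ cong (sum (mapL h (f x)) +_) (sum-concatMap f h xs) ⟩
  sum (mapL h (f x)) + sum (mapL (sum ∘ mapL h ∘ f) xs) ∎
  where open ≡-Reasoning

sum-cong-∈ : ∀ {A : Set} (xs : List A) {f g : A → ℕ} → (∀ {x} → x ∈ xs → f x ≡ g x) → sum (mapL f xs) ≡ sum (mapL g xs)
sum-cong-∈ xs f≡g = cong sum (map-cong-local (All.tabulate f≡g))

module Parent {m : ℕ} (σ : Vec (Fin (suc m)) (suc m)) (good : Good σ) (F : ℕ → ℕ → ℕ) where

  s : ℕ → ℕ
  s = seq σ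
  a b : ℕ
  a = label descent s m
  b = label ascent s m

  module Child d (g : Fin (suc (suc m))) (site : Site d s m (toℕ g)) = ChildLabels
    (seq-append-init σ g) (seq-append-last σ g)
    (seq-onto (append σ g) (append-isPerm σ g (proj₁ good))) (λ p → seq-bounded (append σ g))
    (good⇒goodSeq σ good) (proj₂ site)

  ∑-sites : ∀ d (h : ℕ → ℕ) → sum (mapL (h ∘ toℕ) (sites d σ)) ≡ ∑< (suc (suc m)) (λ q → h q when Site? d s m q)
  ∑-sites d h = trans (sum-filter (Site? d s m ∘ toℕ) (h ∘ toℕ) (allFin (suc (suc m))))
                      (sum-allFin (suc (suc m)) (λ q → h q when Site? d s m q))

  weight-after-ascent : ℕ → ℕ
  weight-after-ascent G = F (suc a) (countFrom (Site? ascent s m) (suc (suc m)) G)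

  weight-after-descent : ℕ → ℕ
  weight-after-descent G = F (suc (count (Site? descent s m) G)) (suc b)

  weight-append-ascent : ∀ {g} → g ∈ sites ascent σ → weight F (append σ g) ≡ weight-after-ascent (toℕ g)
  weight-append-ascent {g} g∈ = cong₂ F label-descent label-ascent
    where
    site : Site ascent s m (toℕ g)
    site = site∈sites ascent σ g∈
    open Child ascent g site
    open Peak (proj₁ site)

  weight-append-descent : ∀ {g} → g ∈ sites descent σ → weight F (append σ g) ≡ weight-after-descent (toℕ g)
  weight-append-descent {g} g∈ = cong₂ F label-descent label-ascent
    where
    site : Site descent s m (toℕ g)
    site = site∈sites descent σ g∈
    open Child descent g site
    open Valley (proj₁ site)

  weight-sites : ∀ d → sum (mapL (weight F ∘ append σ) (sites d σ)) ≡ grow d F a b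
  weight-sites ascent = begin
    sum (mapL (weight F ∘ append σ) (sites ascent σ))         ≡⟨ sum-cong-∈ (sites ascent σ) weight-append-ascent ⟩
    sum (mapL (weight-after-ascent ∘ toℕ) (sites ascent σ))   ≡⟨ ∑-sites ascent weight-after-ascent ⟩
    ∑< (suc (suc m)) (λ q → weight-after-ascent q when Site? ascent s m q)
      ≡⟨ ∑-rank-above (Site? ascent s m) (suc (suc m)) (F (suc a)) ⟩
    grow ascent F a b                                         ∎
    where open ≡-Reasoning
  weight-sites descent = begin
    sum (mapL (weight F ∘ append σ) (sites descent σ))        ≡⟨ sum-cong-∈ (sites descent σ) weight-append-descent ⟩
    sum (mapL (weight-after-descent ∘ toℕ) (sites descent σ)) ≡⟨ ∑-sites descent weight-after-descent ⟩
    ∑< (suc (suc m)) (λ q → weight-after-descent q when Site? descent s m q)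
      ≡⟨ ∑-rank-below (Site? descent s m) (suc (suc m)) (λ c → F (suc c) (suc b)) ⟩
    grow descent F a b                                        ∎
    where open ≡-Reasoning

  weight-children : sum (mapL (weight F) (children σ)) ≡ weight (grow (direction m) F) σ
  weight-children = trans (cong sum (sym (map-∘ (sites (direction m) σ)))) (weight-sites (direction m))

levelSum : ℕ → (ℕ → ℕ → ℕ) → ℕ
levelSum m F = sum (mapL (weight F) (goods m))

levelSum-suc : ∀ m F → levelSum (suc m) F ≡ levelSum m (grow (direction m) F)
levelSum-suc m F = trans (sum-concatMap children (weight F) (goods m))
                         (sum-cong-∈ (goods m) (λ σ∈ → Parent.weight-children _ (goods-sound m σ∈) F))

levelSum-cong : ∀ m {F F′ : ℕ → ℕ → ℕ} → (∀ a b → F a b ≡ F′ a b) → levelSum m F ≡ levelSum m F′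
levelSum-cong m F≡F′ = sum-cong-∈ (goods m) (λ _ → F≡F′ _ _)

direction-even : ∀ k → direction (k + k) ≡ ascent
direction-even zero    = refl
direction-even (suc k) = trans (cong (λ x → direction (suc x)) (+-suc k k)) (direction-even k)

direction-odd : ∀ k → direction (suc (k + k)) ≡ descent
direction-odd zero    = refl
direction-odd (suc k) = trans (cong (λ x → direction (suc (suc x))) (+-suc k k)) (direction-odd k)

ballotProduct : ℕ → ℕ → ℕ → ℕ → ℕ
ballotProduct j j′ a b = ballot j (suc a) * ballot j′ b

grow-grow-ballotProduct : ∀ j j′ a b → grow ascent (grow descent (ballotProduct j j′)) a b ≡ ballotProduct (suc j) (suc j′) a b
grow-grow-ballotProduct j j′ a b =
  trans (∑<-cong b (λ i → ∑<-*ʳ (suc a) (λ i′ → ballot j (2 + i′)) (ballot j′ (2 + i))))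
        (∑<-*ˡ b (λ i → ballot j′ (2 + i)) (ballot (suc j) (suc a)))

-- An ascent step followed by a descent step of the generating tree raises both indices of ballotProduct.
levelSum-ballotProduct : ∀ k j j′ → levelSum (k + k) (ballotProduct j j′) ≡ ballot (k + j) 2 * ballot (k + j′) 1
levelSum-ballotProduct zero    j j′ = +-identityʳ _
levelSum-ballotProduct (suc k) j j′ = begin
  levelSum (suc (k + suc k)) F
    ≡⟨ cong (λ x → levelSum (suc x) F) (+-suc k k) ⟩
  levelSum (suc (suc (k + k))) F
    ≡⟨ levelSum-suc (suc (k + k)) F ⟩
  levelSum (suc (k + k)) (grow (direction (suc (k + k))) F)
    ≡⟨ cong (λ d → levelSum (suc (k + k)) (grow d F)) (direction-odd k) ⟩
  levelSum (suc (k + k)) (grow descent F)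
    ≡⟨ levelSum-suc (k + k) (grow descent F) ⟩
  levelSum (k + k) (grow (direction (k + k)) (grow descent F))
    ≡⟨ cong (λ d → levelSum (k + k) (grow d (grow descent F))) (direction-even k) ⟩
  levelSum (k + k) (grow ascent (grow descent F))
    ≡⟨ levelSum-cong (k + k) (grow-grow-ballotProduct j j′) ⟩
  levelSum (k + k) (ballotProduct (suc j) (suc j′))
    ≡⟨ levelSum-ballotProduct k (suc j) (suc j′) ⟩
  ballot (k + suc j) 2 * ballot (k + suc j′) 1
    ≡⟨ cong₂ (λ x y → ballot x 2 * ballot y 1) (+-suc k j) (+-suc k j′) ⟩
  ballot (suc k + j) 2 * ballot (suc k + j′) 1
    ∎
  where
  open ≡-Reasoning
  F : ℕ → ℕ → ℕ
  F = ballotProduct j j′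

sum-map-const1 : ∀ {A : Set} (xs : List A) → sum (mapL (λ _ → 1) xs) ≡ length xs
sum-map-const1 []       = refl
sum-map-const1 (x ∷ xs) = cong suc (sum-map-const1 xs)

goods-count : ∀ m → HasCount (Good {suc m}) (levelSum m (λ _ _ → 1))
goods-count m = goods m , goods-unique m , sym (sum-map-const1 (goods m)) , λ τ → mk⇔ (goods-sound m) (goods-complete m)

ballot-2≡catalan : ∀ n → ballot n 2 ≡ catalan (suc n)
ballot-2≡catalan n = trans (sym (+-identityʳ (ballot n 2))) (sym (catalan≡ballot (suc n)))

levelSum-odd-size : ∀ n → levelSum (n + n) (λ _ _ → 1) ≡ catalan n * catalan (suc n)
levelSum-odd-size n = begin
  levelSum (n + n) (λ _ _ → 1)          ≡⟨⟩
  levelSum (n + n) (ballotProduct 0 0)  ≡⟨ levelSum-ballotProduct n 0 0 ⟩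
  ballot (n + 0) 2 * ballot (n + 0) 1   ≡⟨ cong₂ (λ x y → ballot x 2 * ballot y 1) (+-identityʳ n) (+-identityʳ n) ⟩
  ballot n 2 * ballot n 1               ≡⟨ cong₂ _*_ (ballot-2≡catalan n) (sym (catalan≡ballot n)) ⟩
  catalan (suc n) * catalan n           ≡⟨ *-comm (catalan (suc n)) (catalan n) ⟩
  catalan n * catalan (suc n)           ∎
  where open ≡-Reasoning

levelSum-even-size : ∀ n → levelSum (n + suc n) (λ _ _ → 1) ≡ catalan (suc n) * catalan (suc n)
levelSum-even-size n = begin
  levelSum (n + suc n) (λ _ _ → 1)                         ≡⟨ cong (λ x → levelSum x (λ _ _ → 1)) (+-suc n n) ⟩
  levelSum (suc (n + n)) (λ _ _ → 1)                       ≡⟨ levelSum-suc (n + n) (λ _ _ → 1) ⟩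
  levelSum (n + n) (grow (direction (n + n)) (λ _ _ → 1))  ≡⟨ cong (λ d → levelSum (n + n) (grow d (λ _ _ → 1))) (direction-even n) ⟩
  levelSum (n + n) (grow ascent (λ _ _ → 1))               ≡⟨ levelSum-cong (n + n) (λ a b → sym (+-identityʳ (ballot 1 b))) ⟩
  levelSum (n + n) (ballotProduct 0 1)                     ≡⟨ levelSum-ballotProduct n 0 1 ⟩
  ballot (n + 0) 2 * ballot (n + 1) 1                      ≡⟨ cong₂ (λ x y → ballot x 2 * ballot y 1) (+-identityʳ n) (+-comm n 1) ⟩
  ballot n 2 * ballot (suc n) 1                            ≡⟨ cong₂ _*_ (ballot-2≡catalan n) (sym (catalan≡ballot (suc n))) ⟩
  catalan (suc n) * catalan (suc n)                        ∎
  where open ≡-Reasoning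

corollary6p10 :
    ((n : ℕ) → HasCount (Good {suc n + suc n}) (catalan (suc n) * catalan (suc n)))
    × ((n : ℕ) → HasCount (Good {suc (n + n)}) (catalan n * catalan (suc n)))
corollary6p10 =
  (λ n → subst (HasCount Good) (levelSum-even-size n) (goods-count (n + suc n))) ,
  (λ n → subst (HasCount Good) (levelSum-odd-size n) (goods-count (n + n)))
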